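{- Let $L_1$ and $L_2$ be LPTSes such that $L_1$ is reactive and $L_1\not\preceq L_2$. Then there exists a reactive stochastic tree $C$ with $C\preceq L_1$ and $C\not\preceq L_2$.
   Context: For a set $S$, $\mathrm{Dist}(S)$ is the set of discrete probability distributions on $S$ (rational probabilities). An LPTS is a tuple $\langle S,s^0,\alpha,\tau\rangle$ with finite state set $S$, start state $s^0$, finite action set $\alpha$ and finite transition relation $\tau\subseteq S\times\alpha\times\mathrm{Dist}(S)$; write $s\xrightarrow{a}\mu$. An LPTS is reactive if each state has at most one transition on each action. A stochastic tree is an LPTS in which the start state is not in the support of any distribution occurring in a transition and every other state is in the support of exactly one such distribution. For LPTSes $L_i=\langle S_i,s^0_i,\alpha_i,\tau_i\rangle$ and $R\subseteq S_1\times S_2$, $\mu_1\sqsubseteq_R\mu_2$ iff there is $w:S_1\times S_2\to\mathbb{Q}\cap[0,1]$ with $\mu_1(s_1)=\sum_{s_2}w(s_1,s_2)$, $\mu_2(s_2)=\sum_{s_1}w(s_1,s_2)$, and $w(s_1,s_2)>0\Rightarrow s_1Rs_2$. $R$ is a strong simulation iff whenever $s_1Rs_2$ and $s_1\xrightarrow{a}\mu_1$ there is $s_2\xrightarrow{a}\mu_2$ with $\mu_1\sqsubseteq_R\mu_2$; $L_1\preceq L_2$ iff some strong simulation contains $(s^0_1,s^0_2)$. -}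

module Defs where

open import Level using (0ℓ)
open import Data.Nat using (ℕ; zero; suc)
open import Data.Fin using (Fin)
import Data.Fin as F
open import Data.Rational using (ℚ; 0ℚ; 1ℚ; _+_; _≤_; _<_)
open import Data.List using (List)
open import Data.List.Membership.Propositional using (_∈_)
open import Data.Product using (Σ; _×_; _,_; ∃-syntax)
open import Relation.Binary.PropositionalEquality using (_≡_)
open import Relation.Nullary using (¬_)

sumFin : {n : ℕ} → (Fin n → ℚ) → ℚ
sumFin {zero}  f = 0ℚ
sumFin {suc n} f = f F.zero + sumFin (λ i → f (F.suc i))

-- Actions are drawn from a fixed countable universe (ℕ); each LPTS
-- has its own finite action set (a list of actions).
Action : Set
Action = ℕ

record Dist (n : ℕ) : Set where
  field
    prob    : Fin n → ℚ
    nonneg  : ∀ s → 0ℚ ≤ prob s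
    sums-to-1 : sumFin prob ≡ 1ℚ
open Dist public

_≗D_ : {n : ℕ} → Dist n → Dist n → Set
μ ≗D ν = ∀ s → prob μ s ≡ prob ν s

record Transition (n : ℕ) : Set where
  constructor tr
  field
    src : Fin n
    act : Action
    tgt : Dist n
open Transition public

record LPTS : Set where
  field
    states : ℕ
    start  : Fin states
    acts   : List Action
    trans  : List (Transition states)
    trans-acts : ∀ {t} → t ∈ trans → act t ∈ acts
open LPTS public

Step : (L : LPTS) → Fin (states L) → Action → Dist (states L) → Set
Step L s a μ = tr s a μ ∈ trans L

Reactive : LPTS → Set
Reactive L = ∀ {s a μ ν} → Step L s a μ → Step L s a ν → μ ≗D ν

StochasticTree : LPTS → Set
StochasticTree L =
  (∀ {t} → t ∈ trans L → ¬ (0ℚ < prob (tgt t) (start L)))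
  × (∀ s → ¬ (s ≡ start L) →
       Σ (Transition (states L)) λ t → (t ∈ trans L) × (0ℚ < prob (tgt t) s)
         × (∀ t' → t' ∈ trans L → 0ℚ < prob (tgt t') s →
              (src t' ≡ src t) × (act t' ≡ act t) × (tgt t' ≗D tgt t)))

Lift : {n₁ n₂ : ℕ} → (Fin n₁ → Fin n₂ → Set) → Dist n₁ → Dist n₂ → Set
Lift {n₁} {n₂} R μ₁ μ₂ =
  Σ (Fin n₁ → Fin n₂ → ℚ) λ w →
    (∀ s₁ s₂ → (0ℚ ≤ w s₁ s₂) × (w s₁ s₂ ≤ 1ℚ))
    × (∀ s₁ → prob μ₁ s₁ ≡ sumFin (λ s₂ → w s₁ s₂))
    × (∀ s₂ → prob μ₂ s₂ ≡ sumFin (λ s₁ → w s₁ s₂))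
    × (∀ s₁ s₂ → 0ℚ < w s₁ s₂ → R s₁ s₂)

IsStrongSimulation : (L₁ L₂ : LPTS) → (Fin (states L₁) → Fin (states L₂) → Set) → Set
IsStrongSimulation L₁ L₂ R =
  ∀ s₁ s₂ → R s₁ s₂ → ∀ a μ₁ → Step L₁ s₁ a μ₁ →
    Σ (Dist (states L₂)) λ μ₂ → Step L₂ s₂ a μ₂ × Lift R μ₁ μ₂

_⪯_ : LPTS → LPTS → Set₁
L₁ ⪯ L₂ = Σ (Fin (states L₁) → Fin (states L₂) → Set) λ R →
  IsStrongSimulation L₁ L₂ R × R (start L₁) (start L₂)

module Submission where

-- Unfold L₁ from its start state into a tree C of depth K = |S₁|·|S₂|: a node is a path of at
-- most K transitions of L₁ along targets of positive probability, and each transition of C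
-- pushes the target distribution of L₁ forward along "extend the path by this step". Taking
-- a single canonical transition of L₁ per state and action makes C reactive, and since L₁ is
-- reactive nothing is lost. The codes in Fin N that are not paths get a self-loop, so that
-- they too lie in the support of exactly one distribution. C is simulated by L₁ through "the
-- last state of the path". Conversely, a simulation of C by L₂ yields the K-step approximant
-- of strong simulation between the start states of L₁ and L₂. The approximants form a
-- descending chain of relations on |S₁|·|S₂| pairs, so one of the first K + 1 is stable; it
-- is then a strong simulation, contradicting L₁ ⋠ L₂.

open import Defs renaming (trans to transitions)
import Algebra.Properties.CommutativeMonoid.Sum as CommutativeMonoidSum
open import Data.Bool using (if_then_else_)
open import Data.Empty using (⊥-elim)
open import Data.Fin using (Fin; zero; suc; _≟_; combine; remQuot; funToFin; finToFun)
open import Data.Fin.Properties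
  using (any?; ∀-cons; ¬∀⟶∃¬; remQuot-combine; combine-remQuot; funToFin-finToFin; finToFun-funToFin)
open import Data.Fin.Subset as Subset using (Subset; inside; outside; ∣_∣)
open import Data.Fin.Subset.Properties using (∣p∣≤n; p⊂q⇒∣p∣<∣q∣)
open import Data.List as List using (List; _∷_; [_]; length; map; filter; concatMap; allFin)
open import Data.List.Membership.Propositional using (_∈_; lose)
open import Data.List.Membership.Propositional.Properties
  using (∈-map⁺; ∈-map⁻; ∈-filter⁺; ∈-filter⁻; ∈-concatMap⁺; ∈-concatMap⁻; ∈-allFin; ∈-lookup)
open import Data.List.Relation.Unary.Any using (here; there; satisfied; index)
open import Data.List.Relation.Unary.Any.Properties using (lookup-index)
open import Data.Maybe using (Maybe; just; nothing)
open import Data.Maybe.Properties as Maybe using (just-injective)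
open import Data.Nat as ℕ using (ℕ)
import Data.Nat.Properties as ℕ
open import Data.Product using (Σ; Σ-syntax; ∃-syntax; _×_; _,_; proj₁; proj₂; uncurry)
open import Data.Product.Properties using () renaming (≡-dec to ×-≡-dec)
open import Data.Rational using (ℚ; 0ℚ; 1ℚ; _+_; _≤_; _<_; _<?_)
import Data.Rational.Properties as ℚ
open import Data.Unit using (⊤; tt)
open import Data.Vec using (Vec; []; _∷_; replicate; tabulate; lookup)
open import Data.Vec.Properties
  using (lookup∘tabulate; tabulate∘lookup; tabulate-cong; []=⇒lookup; lookup⇒[]=; ∷-injective; ∷-injectiveʳ)
open import Function using (_∘_; mk⇔)
open import Function.Definitions using (Injective)
open import Level using (Level)
open import Relation.Binary.Definitions using (DecidableEquality)
open import Relation.Binary.PropositionalEquality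
  using (_≡_; _≢_; refl; sym; trans; cong; cong₂; subst; module ≡-Reasoning)
open import Relation.Nullary using (¬_; Dec; does; yes; no; _→-dec_; _×-dec_)
open import Relation.Nullary.Decidable using (does-⇔; decidable-stable; ¬¬-excluded-middle; map′)
open import Relation.Unary using (Pred; Decidable; _⊆_)

private
  variable
    ℓ : Level
    m n : ℕ

sumFin-cong : {f g : Fin n → ℚ} → (∀ i → f i ≡ g i) → sumFin f ≡ sumFin g
sumFin-cong {ℕ.zero}  f≗g = refl
sumFin-cong {ℕ.suc n} f≗g = cong₂ _+_ (f≗g zero) (sumFin-cong (f≗g ∘ suc))

sumFin-zero : {f : Fin n → ℚ} → (∀ i → f i ≡ 0ℚ) → sumFin f ≡ 0ℚ
sumFin-zero {ℕ.zero}  f≗0 = refl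
sumFin-zero {ℕ.suc n} f≗0 = cong₂ _+_ (f≗0 zero) (sumFin-zero (f≗0 ∘ suc))

private
  module Σℚ = CommutativeMonoidSum ℚ.+-0-commutativeMonoid

  sumFin≡sum : (f : Fin n → ℚ) → sumFin f ≡ Σℚ.sum f
  sumFin≡sum {ℕ.zero}  f = refl
  sumFin≡sum {ℕ.suc n} f = cong (f zero +_) (sumFin≡sum (f ∘ suc))

sumFin-comm : (f : Fin m → Fin n → ℚ) →
  sumFin (λ i → sumFin (f i)) ≡ sumFin (λ j → sumFin (λ i → f i j))
sumFin-comm f = begin
  sumFin (λ i → sumFin (f i))              ≡⟨ sumFin-cong (sumFin≡sum ∘ f) ⟩
  sumFin (λ i → Σℚ.sum (f i))              ≡⟨ sumFin≡sum (λ i → Σℚ.sum (f i)) ⟩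
  Σℚ.sum (λ i → Σℚ.sum (f i))              ≡⟨ Σℚ.∑-comm f ⟩
  Σℚ.sum (λ j → Σℚ.sum (λ i → f i j))      ≡⟨ sym (sumFin≡sum (λ j → Σℚ.sum (λ i → f i j))) ⟩
  sumFin (λ j → Σℚ.sum (λ i → f i j))      ≡⟨ sumFin-cong (λ j → sym (sumFin≡sum (λ i → f i j))) ⟩
  sumFin (λ j → sumFin (λ i → f i j))      ∎
  where open ≡-Reasoning

sumFin-nonneg : {f : Fin n → ℚ} → (∀ i → 0ℚ ≤ f i) → 0ℚ ≤ sumFin f
sumFin-nonneg {ℕ.zero}  f≥0 = ℚ.≤-refl
sumFin-nonneg {ℕ.suc n} f≥0 = ℚ.+-mono-≤ (f≥0 zero) (sumFin-nonneg (f≥0 ∘ suc))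

term≤sumFin : {f : Fin n → ℚ} → (∀ i → 0ℚ ≤ f i) → ∀ i → f i ≤ sumFin f
term≤sumFin {ℕ.suc n} {f} f≥0 zero = begin
  f zero                   ≡⟨ ℚ.+-identityʳ (f zero) ⟨
  f zero + 0ℚ              ≤⟨ ℚ.+-monoʳ-≤ (f zero) (sumFin-nonneg (f≥0 ∘ suc)) ⟩
  f zero + sumFin (f ∘ suc) ∎
  where open ℚ.≤-Reasoning
term≤sumFin {ℕ.suc n} {f} f≥0 (suc i) = begin
  f (suc i)                ≤⟨ term≤sumFin (f≥0 ∘ suc) i ⟩
  sumFin (f ∘ suc)          ≡⟨ ℚ.+-identityˡ _ ⟨
  0ℚ + sumFin (f ∘ suc)     ≤⟨ ℚ.+-monoˡ-≤ _ (f≥0 zero) ⟩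
  f zero + sumFin (f ∘ suc) ∎
  where open ℚ.≤-Reasoning

sumFin-positive : {f : Fin n → ℚ} → (∀ i → 0ℚ ≤ f i) → 0ℚ < sumFin f → ∃[ i ] 0ℚ < f i
sumFin-positive {ℕ.zero}  f≥0 0<0 = ⊥-elim (ℚ.<-irrefl refl 0<0)
sumFin-positive {ℕ.suc n} {f} f≥0 0<Σ with 0ℚ <? f zero
... | yes 0<f₀ = zero , 0<f₀
... | no 0≮f₀  = let i , 0<fᵢ = sumFin-positive (f≥0 ∘ suc) 0<tail in suc i , 0<fᵢ
  where
  f₀≡0 : f zero ≡ 0ℚ
  f₀≡0 = ℚ.≤-antisym (ℚ.≮⇒≥ 0≮f₀) (f≥0 zero)
  0<tail : 0ℚ < sumFin (f ∘ suc)
  0<tail = subst (0ℚ <_) (trans (cong (_+ sumFin (f ∘ suc)) f₀≡0) (ℚ.+-identityˡ _)) 0<Σ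

[_≟_]·_ : Fin n → Fin n → ℚ → ℚ
[ i ≟ c ]· x = if does (i ≟ c) then x else 0ℚ

[]·-nonneg : {i c : Fin n} {x : ℚ} → 0ℚ ≤ x → 0ℚ ≤ [ i ≟ c ]· x
[]·-nonneg {i = i} {c} 0≤x with i ≟ c
... | yes _ = 0≤x
... | no _  = ℚ.≤-refl

[]·-≢ : {i c : Fin n} (x : ℚ) → i ≢ c → [ i ≟ c ]· x ≡ 0ℚ
[]·-≢ {i = i} {c} x i≢c with i ≟ c
... | yes i≡c = ⊥-elim (i≢c i≡c)
... | no _    = refl

[]·-positive : {i c : Fin n} {x : ℚ} → 0ℚ < [ i ≟ c ]· x → i ≡ c × 0ℚ < x
[]·-positive {i = i} {c} 0<x with i ≟ c
... | yes i≡c = i≡c , 0<x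
... | no _    = ⊥-elim (ℚ.<-irrefl refl 0<x)

sumFin-point : (c : Fin n) (f : Fin n → ℚ) → sumFin (λ i → [ i ≟ c ]· f i) ≡ f c
sumFin-point {ℕ.suc n} zero f =
  trans (cong (f zero +_) (sumFin-zero {n} (λ _ → refl))) (ℚ.+-identityʳ (f zero))
sumFin-point (suc c) f = trans (ℚ.+-identityˡ _) (sumFin-point c (f ∘ suc))

sumFin-point-injective : {f : Fin m → Fin n} → Injective _≡_ _≡_ f → (x : Fin m) (g : Fin m → ℚ) →
  sumFin (λ x′ → [ f x ≟ f x′ ]· g x′) ≡ g x
sumFin-point-injective {f = f} inj x g = trans (sumFin-cong tests-agree) (sumFin-point x g)
  where
  tests-agree : ∀ x′ → [ f x ≟ f x′ ]· g x′ ≡ [ x′ ≟ x ]· g x′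
  tests-agree x′ = cong (if_then g x′ else 0ℚ) (does-⇔ (mk⇔ (sym ∘ inj) (cong f ∘ sym)) (f x ≟ f x′) (x′ ≟ x))

sumFin-image : {f : Fin m → Fin n} → Injective _≡_ _≡_ f → (g : Fin n → ℚ) →
  (∀ y → (∀ x → y ≢ f x) → g y ≡ 0ℚ) → sumFin g ≡ sumFin (g ∘ f)
sumFin-image {f = f} inj g g-outside = begin
  sumFin g                                            ≡⟨ sumFin-cong spread ⟩
  sumFin (λ y → sumFin (λ x → [ y ≟ f x ]· g (f x)))  ≡⟨ sumFin-comm (λ y x → [ y ≟ f x ]· g (f x)) ⟩
  sumFin (λ x → sumFin (λ y → [ y ≟ f x ]· g (f x)))  ≡⟨ sumFin-cong (λ x → sumFin-point (f x) (λ _ → g (f x))) ⟩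
  sumFin (g ∘ f)                                      ∎
  where
  open ≡-Reasoning
  spread : ∀ y → g y ≡ sumFin (λ x → [ y ≟ f x ]· g (f x))
  spread y with any? (λ x → y ≟ f x)
  ... | yes (x , refl) = sym (sumFin-point-injective inj x (g ∘ f))
  ... | no y∉im = trans (g-outside y (λ x y≡fx → y∉im (x , y≡fx)))
                        (sym (sumFin-zero (λ x → []·-≢ _ (λ y≡fx → y∉im (x , y≡fx)))))

prob≤1 : (μ : Dist n) (x : Fin n) → prob μ x ≤ 1ℚ
prob≤1 μ x = subst (prob μ x ≤_) (sums-to-1 μ) (term≤sumFin (nonneg μ) x)

-- Opaque, so that prob (push f μ) y stays a neutral term for unification.
opaque
  push : (Fin m → Fin n) → Dist m → Dist n
  prob (push f μ) y = sumFin (λ x → [ y ≟ f x ]· prob μ x)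
  nonneg (push f μ) y = sumFin-nonneg (λ x → []·-nonneg {i = y} {f x} (nonneg μ x))
  sums-to-1 (push f μ) = begin
    sumFin (λ y → sumFin (λ x → [ y ≟ f x ]· prob μ x))  ≡⟨ sumFin-comm (λ y x → [ y ≟ f x ]· prob μ x) ⟩
    sumFin (λ x → sumFin (λ y → [ y ≟ f x ]· prob μ x))  ≡⟨ sumFin-cong (λ x → sumFin-point (f x) (λ _ → prob μ x)) ⟩
    sumFin (prob μ)                                      ≡⟨ sums-to-1 μ ⟩
    1ℚ                                                   ∎
    where open ≡-Reasoning

  push-apply : {f : Fin m → Fin n} → Injective _≡_ _≡_ f → (μ : Dist m) (x : Fin m) →
    prob (push f μ) (f x) ≡ prob μ x
  push-apply inj μ x = sumFin-point-injective inj x (prob μ)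

  push-outside : {f : Fin m → Fin n} (μ : Dist m) {y : Fin n} → (∀ x → y ≢ f x) → prob (push f μ) y ≡ 0ℚ
  push-outside μ y∉im = sumFin-zero (λ x → []·-≢ _ (y∉im x))

  push-support : (f : Fin m → Fin n) (μ : Dist m) (y : Fin n) →
    0ℚ < prob (push f μ) y → ∃[ x ] y ≡ f x × 0ℚ < prob μ x
  push-support f μ y 0<ν with sumFin-positive (λ x → []·-nonneg {i = y} {f x} (nonneg μ x)) 0<ν
  ... | x , 0<term = x , []·-positive 0<term

  push-coupling : (f : Fin m → Fin n) (μ : Dist m) → Lift (λ y x → y ≡ f x × 0ℚ < prob μ x) (push f μ) μ
  push-coupling {m} {n} f μ =
    w , bounded , (λ _ → refl) , (λ x → sym (sumFin-point (f x) (λ _ → prob μ x))) , λ _ _ → []·-positive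
    where
    w : Fin n → Fin m → ℚ
    w y x = [ y ≟ f x ]· prob μ x
    bounded : ∀ y x → 0ℚ ≤ w y x × w y x ≤ 1ℚ
    bounded y x with y ≟ f x
    ... | yes _ = nonneg μ x , prob≤1 μ x
    ... | no _  = ℚ.≤-refl , ℚ.nonNegative⁻¹ 1ℚ

unit : Dist 1
prob unit _ = 1ℚ
nonneg unit _ = ℚ.nonNegative⁻¹ 1ℚ
sums-to-1 unit = ℚ.+-identityʳ 1ℚ

dirac : Fin n → Dist n
dirac c = push (λ _ → c) unit

dirac-self : (c : Fin n) → 0ℚ < prob (dirac c) c
dirac-self c =
  subst (0ℚ <_) (sym (push-apply {f = λ _ → c} (λ { {zero} {zero} _ → refl }) unit zero)) (ℚ.positive⁻¹ 1ℚ)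

dirac-support : (c y : Fin n) → 0ℚ < prob (dirac c) y → y ≡ c
dirac-support c y pos = proj₁ (proj₂ (push-support (λ _ → c) unit y pos))

Lift-mono : {n₁ n₂ : ℕ} {R R′ : Fin n₁ → Fin n₂ → Set} {μ : Dist n₁} {ν : Dist n₂} →
  (∀ x y → R x y → R′ x y) → Lift R μ ν → Lift R′ μ ν
Lift-mono R⇒R′ (w , bounded , left , right , support) =
  w , bounded , left , right , λ x y → R⇒R′ x y ∘ support x y

Lift-≗ˡ : {n₁ n₂ : ℕ} {R : Fin n₁ → Fin n₂ → Set} {μ μ′ : Dist n₁} {ν : Dist n₂} →
  μ ≗D μ′ → Lift R μ ν → Lift R μ′ ν
Lift-≗ˡ μ≗μ′ (w , bounded , left , right , support) =
  w , bounded , (λ x → trans (sym (μ≗μ′ x)) (left x)) , right , support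

Lift-push⁻ : {n′ : ℕ} {R : Fin n → Fin n′ → Set} {f : Fin m → Fin n} {μ : Dist m} {ν : Dist n′} →
  Injective _≡_ _≡_ f → Lift R (push f μ) ν → Lift (λ x y → R (f x) y × 0ℚ < prob μ x) μ ν
Lift-push⁻ {R = R} {f} {μ} {ν} inj (w , bounded , left , right , support) =
  (w ∘ f) , bounded ∘ f , left′ , right′ , support′
  where
  w≤row : ∀ x y → w x y ≤ prob (push f μ) x
  w≤row x y = subst (w x y ≤_) (sym (left x)) (term≤sumFin (λ y′ → proj₁ (bounded x y′)) y)

  left′ : ∀ x → prob μ x ≡ sumFin (w (f x))
  left′ x = trans (sym (push-apply inj μ x)) (left (f x))

  right′ : ∀ y → prob ν y ≡ sumFin (λ x → w (f x) y)
  right′ y = trans (right y) (sumFin-image inj (λ x → w x y) vanishes)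
    where
    vanishes : ∀ x → (∀ x′ → x ≢ f x′) → w x y ≡ 0ℚ
    vanishes x x∉im = ℚ.≤-antisym (subst (w x y ≤_) (push-outside μ x∉im) (w≤row x y)) (proj₁ (bounded x y))

  support′ : ∀ x y → 0ℚ < w (f x) y → R (f x) y × 0ℚ < prob μ x
  support′ x y 0<w = support (f x) y 0<w
                   , ℚ.<-≤-trans 0<w (subst (w (f x) y ≤_) (push-apply inj μ x) (w≤row (f x) y))

¬¬-∀ : {P : Fin n → Set ℓ} → (∀ i → ¬ ¬ P i) → ¬ ¬ (∀ i → P i)
¬¬-∀ {ℕ.zero}  ¬¬P ¬∀P = ¬∀P (λ ())
¬¬-∀ {ℕ.suc n} ¬¬P ¬∀P = ¬¬P zero (λ P₀ → ¬¬-∀ (¬¬P ∘ suc) (λ P₊ → ¬∀P (∀-cons P₀ P₊)))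

toSubset : {P : Pred (Fin n) ℓ} → Decidable P → Subset n
toSubset P? = tabulate (λ i → if does (P? i) then inside else outside)

∈-toSubset⁺ : {P : Pred (Fin n) ℓ} (P? : Decidable P) {i : Fin n} → P i → i Subset.∈ toSubset P?
∈-toSubset⁺ P? {i} Pi with P? i in eq
... | yes _  =
  lookup⇒[]= i _ (trans (lookup∘tabulate _ i) (cong (if_then inside else outside) (cong does eq)))
... | no ¬Pi = ⊥-elim (¬Pi Pi)

∈-toSubset⁻ : {P : Pred (Fin n) ℓ} (P? : Decidable P) {i : Fin n} → i Subset.∈ toSubset P? → P i
∈-toSubset⁻ P? {i} i∈ with P? i in eq
... | yes Pi = Pi
... | no _
  with () ← trans (sym ([]=⇒lookup i∈)) (trans (lookup∘tabulate _ i) (cong (if_then inside else outside) (cong does eq)))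

-- Constructively each P k is decidable only under a double negation, which is enough for a
-- negative conclusion; while the chain keeps shrinking strictly, ∣ P k ∣ + k ≤ n.
descending-chain-stabilises : (P : ℕ → Pred (Fin n) ℓ) → (∀ k → P (ℕ.suc k) ⊆ P k) →
  ¬ (∀ k → k ℕ.≤ n → ¬ (P k ⊆ P (ℕ.suc k)))
descending-chain-stabilises {n} P P-suc⊆P unstable = measured (ℕ.suc n) overflow
  where
  Measured : ℕ → Set _
  Measured k = Σ (Decidable (P k)) λ P? → ∣ toSubset P? ∣ ℕ.+ k ℕ.≤ n

  overflow : ¬ Measured (ℕ.suc n)
  overflow (P? , bound) = ℕ.<-irrefl refl (ℕ.≤-trans (ℕ.m≤n+m (ℕ.suc n) _) bound)

  shrinks : ∀ k (P? : Decidable (P k)) (P′? : Decidable (P (ℕ.suc k))) →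
    ∣ toSubset P? ∣ ℕ.+ k ℕ.≤ n → ∣ toSubset P′? ∣ ℕ.+ ℕ.suc k ℕ.≤ n
  shrinks k P? P′? bound = begin
    ∣ toSubset P′? ∣ ℕ.+ ℕ.suc k  ≡⟨ ℕ.+-suc _ k ⟩
    ℕ.suc (∣ toSubset P′? ∣ ℕ.+ k) ≤⟨ ℕ.+-monoˡ-< k (p⊂q⇒∣p∣<∣q∣ P′⊂P) ⟩
    ∣ toSubset P? ∣ ℕ.+ k          ≤⟨ bound ⟩
    n                              ∎
    where
    open ℕ.≤-Reasoning
    escapee : ∃[ i ] ¬ (P k i → P (ℕ.suc k) i)
    escapee = ¬∀⟶∃¬ n _ (λ i → P? i →-dec P′? i)
      (λ P⊆P′ → unstable k (ℕ.≤-trans (ℕ.m≤n+m k _) bound) (λ {i} → P⊆P′ i))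
    P′⊂P : toSubset P′? Subset.⊂ toSubset P?
    P′⊂P = (∈-toSubset⁺ P? ∘ P-suc⊆P k ∘ ∈-toSubset⁻ P′?)
           , let i , escapes = escapee in
             i , ∈-toSubset⁺ P? (decidable-stable (P? i) (λ ¬Pi → escapes (⊥-elim ∘ ¬Pi)))
               , (escapes ∘ (λ P′i _ → P′i) ∘ ∈-toSubset⁻ P′?)

  measured : ∀ k → ¬ ¬ Measured k
  measured ℕ.zero ¬m = ¬¬-∀ (λ _ → ¬¬-excluded-middle)
    (λ P? → ¬m (P? , subst (ℕ._≤ n) (sym (ℕ.+-identityʳ _)) (∣p∣≤n (toSubset P?))))
  measured (ℕ.suc k) ¬m = measured k (λ (P? , bound) → ¬¬-∀ (λ _ → ¬¬-excluded-middle)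
    (λ P′? → ¬m (P′? , shrinks k P? P′? bound)))

module _ (L₁ L₂ : LPTS) where

  Sim : ℕ → Fin (states L₁) → Fin (states L₂) → Set
  Sim ℕ.zero    _ _ = ⊤
  Sim (ℕ.suc k) s t = ∀ a μ → Step L₁ s a μ → Σ[ ν ∈ Dist (states L₂) ] Step L₂ t a ν × Lift (Sim k) μ ν

  Sim-antitone : {k k′ : ℕ} → k ℕ.≤ k′ → ∀ s t → Sim k′ s t → Sim k s t
  Sim-antitone ℕ.z≤n       s t _   = tt
  Sim-antitone (ℕ.s≤s k≤k′) s t sim a μ step =
    let ν , step′ , lift = sim a μ step in ν , step′ , Lift-mono {μ = μ} {ν} (Sim-antitone k≤k′) lift

  ¬⪯⇒¬Sim : ¬ (L₁ ⪯ L₂) → ¬ Sim (states L₁ ℕ.* states L₂) (start L₁) (start L₂)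
  ¬⪯⇒¬Sim L₁⋠L₂ simᴺ = descending-chain-stabilises P (λ k → Sim-antitone (ℕ.n≤1+n k) _ _) unstable
    where
    P : ℕ → Pred (Fin (states L₁ ℕ.* states L₂)) _
    P k = uncurry (Sim k) ∘ remQuot (states L₂)
    unstable : ∀ k → k ℕ.≤ states L₁ ℕ.* states L₂ → ¬ (P k ⊆ P (ℕ.suc k))
    unstable k k≤N P⊆P′ = L₁⋠L₂ (Sim k , stable , Sim-antitone k≤N _ _ simᴺ)
      where
      stable : ∀ s t → Sim k s t → Sim (ℕ.suc k) s t
      stable s t = subst (uncurry (Sim (ℕ.suc k))) (remQuot-combine s t)
                 ∘ P⊆P′ ∘ subst (uncurry (Sim k)) (sym (remQuot-combine s t))

-- Paths of length at most k in a graph, padded with trailing nothings to length exactly k.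
module Paths {S A : Set} (Edge : S → A → Set) (target : A → S) where

  Path : ℕ → Set
  Path = Vec (Maybe A)

  empty : {k : ℕ} → Path k
  empty = replicate _ nothing

  data Valid : {k : ℕ} → S → Path k → Set where
    []   : {s : S} → Valid s []
    stop : {s : S} {k : ℕ} → Valid s (nothing ∷ empty {k})
    _∷_  : {s : S} {k : ℕ} {x : A} {p : Path k} → Edge s x → Valid (target x) p → Valid s (just x ∷ p)

  last : {k : ℕ} → S → Path k → S
  last s []            = s
  last s (nothing ∷ _) = s
  last s (just x ∷ p)  = last (target x) p

  free : {k : ℕ} → Path k → ℕ
  free []            = 0
  free (nothing ∷ p) = ℕ.suc (free p)
  free (just _ ∷ p)  = free p

  child : {k : ℕ} → Path k → A → Path k
  child []            x = []
  child (nothing ∷ p) x = just x ∷ p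
  child (just y ∷ p)  x = just y ∷ child p x

  private
    variable
      k : ℕ
      s : S
      x x′ : A
      p p′ : Path k

  empty? : (p : Path k) → Dec (p ≡ empty)
  empty? []            = yes refl
  empty? (nothing ∷ p) = map′ (cong (nothing ∷_)) ∷-injectiveʳ (empty? p)
  empty? (just _ ∷ p)  = no λ ()

  valid? : ((s : S) (x : A) → Dec (Edge s x)) → (s : S) (p : Path k) → Dec (Valid s p)
  valid? edge? s []            = yes []
  valid? edge? s (nothing ∷ p) = map′ (λ { refl → stop }) (λ { stop → refl }) (empty? p)
  valid? edge? s (just x ∷ p)  =
    map′ (uncurry _∷_) (λ { (e ∷ v) → e , v }) (edge? s x ×-dec valid? edge? (target x) p)

  valid-empty : Valid s (empty {k})
  valid-empty {k = ℕ.zero}  = []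
  valid-empty {k = ℕ.suc k} = stop

  last-empty : last s (empty {k}) ≡ s
  last-empty {k = ℕ.zero}  = refl
  last-empty {k = ℕ.suc k} = refl

  free-empty : free (empty {k}) ≡ k
  free-empty {k = ℕ.zero}  = refl
  free-empty {k = ℕ.suc k} = cong ℕ.suc free-empty

  child-free : (p : Path k) → 0 ℕ.< free p → ℕ.suc (free (child p x)) ≡ free p
  child-free (nothing ∷ p) _      = refl
  child-free (just _ ∷ p)  0<free = child-free p 0<free

  child≢empty : (p : Path k) → 0 ℕ.< free p → child p x ≢ empty
  child≢empty (nothing ∷ _) _ ()
  child≢empty (just _ ∷ _)  _ ()

  child-valid : Valid s p → 0 ℕ.< free p → Edge (last s p) x → Valid s (child p x)
  child-valid stop     _      e = e ∷ valid-empty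
  child-valid (e ∷ v) 0<free e′ = e ∷ child-valid v 0<free e′

  child-last : Valid s p → 0 ℕ.< free p → last s (child p x) ≡ target x
  child-last (stop {k = k}) _ = last-empty {k = k}
  child-last (_ ∷ v) 0<free = child-last v 0<free

  child-injective : {s s′ : S} → Valid s p → Valid s′ p′ → 0 ℕ.< free p → 0 ℕ.< free p′ →
    child p x ≡ child p′ x′ → p ≡ p′ × x ≡ x′
  child-injective stop     stop      _ _ eq = refl , just-injective (proj₁ (∷-injective eq))
  child-injective stop     (_ ∷ v′)  _ f′ eq = ⊥-elim (child≢empty _ f′ (sym (proj₂ (∷-injective eq))))
  child-injective (_ ∷ v)  stop      f _ eq = ⊥-elim (child≢empty _ f (proj₂ (∷-injective eq)))
  child-injective (_ ∷ v)  (_ ∷ v′)  f f′ eq with ∷-injective eq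
  ... | refl , tails with child-injective v v′ f f′ tails
  ...   | refl , refl = refl , refl

  record Parent (s : S) (q : Path k) : Set where
    field
      path   : Path k
      label  : A
      splits : q ≡ child path label
      valid  : Valid s path
      room   : 0 ℕ.< free path
      edge   : Edge (last s path) label

  parent : Valid s p → p ≢ empty → Parent s p
  parent []       p≢empty = ⊥-elim (p≢empty refl)
  parent stop     p≢empty = ⊥-elim (p≢empty refl)
  parent {p = just x ∷ p} (e ∷ v) _ with empty? p
  ... | yes refl = record { path = nothing ∷ empty ; label = x ; splits = refl ; valid = stop
                          ; room = ℕ.s≤s ℕ.z≤n ; edge = e }
  ... | no p≢empty = record { path = just x ∷ path ; label = label ; splits = cong (just x ∷_) splits
                            ; valid = e ∷ valid ; room = room ; edge = edge }
    where open Parent (parent v p≢empty)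

funToFin-cong : {f g : Fin m → Fin n} → (∀ i → f i ≡ g i) → funToFin f ≡ funToFin g
funToFin-cong {ℕ.zero}  f≗g = refl
funToFin-cong {ℕ.suc m} f≗g = cong₂ combine (f≗g zero) (funToFin-cong (f≗g ∘ suc))

module VecCoding {C : Set} {b : ℕ} (toFin : C → Fin b) (fromFin : Fin b → C)
  (fromFin-toFin : ∀ c → fromFin (toFin c) ≡ c) (toFin-fromFin : ∀ i → toFin (fromFin i) ≡ i)
  (k : ℕ) where

  encode : Vec C k → Fin (b ℕ.^ k)
  encode v = funToFin (toFin ∘ lookup v)

  decode : Fin (b ℕ.^ k) → Vec C k
  decode i = tabulate (fromFin ∘ finToFun i)

  decode-encode : (v : Vec C k) → decode (encode v) ≡ v
  decode-encode v = trans (tabulate-cong (λ i → trans (cong fromFin (finToFun-funToFin _ i)) (fromFin-toFin _)))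
                          (tabulate∘lookup v)

  encode-decode : (i : Fin (b ℕ.^ k)) → encode (decode i) ≡ i
  encode-decode i = trans (funToFin-cong {k} (λ j → trans (cong toFin (lookup∘tabulate (fromFin ∘ finToFun i) j))
                                                      (toFin-fromFin _)))
                          (funToFin-finToFin {k} i)

  encode-injective : {v w : Vec C k} → encode v ≡ encode w → v ≡ w
  encode-injective {v} {w} eq = trans (sym (decode-encode v)) (trans (cong decode eq) (decode-encode w))

module MaybePairCoding (m n : ℕ) where

  toFin : Maybe (Fin m × Fin n) → Fin (ℕ.suc (m ℕ.* n))
  toFin nothing        = zero
  toFin (just (j , s)) = suc (combine j s)

  fromFin : Fin (ℕ.suc (m ℕ.* n)) → Maybe (Fin m × Fin n)
  fromFin zero    = nothing
  fromFin (suc i) = just (remQuot n i)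

  fromFin-toFin : ∀ c → fromFin (toFin c) ≡ c
  fromFin-toFin nothing        = refl
  fromFin-toFin (just (j , s)) = cong just (remQuot-combine j s)

  toFin-fromFin : ∀ i → toFin (fromFin i) ≡ i
  toFin-fromFin zero    = refl
  toFin-fromFin (suc i) = cong suc (combine-remQuot {m} n i)

module Representatives {Key : Set} (_≟ₖ_ : DecidableEquality Key) {m : ℕ} (key : Fin m → Key) where

  first : Key → Maybe (Fin m)
  first κ with any? (λ i → key i ≟ₖ κ)
  ... | yes (i , _) = just i
  ... | no _        = nothing

  Canonical : Fin m → Set
  Canonical j = first (key j) ≡ just j

  canonical? : (j : Fin m) → Dec (Canonical j)
  canonical? j = Maybe.≡-dec _≟_ (first (key j)) (just j)

  canonical-unique : {j j′ : Fin m} → Canonical j → Canonical j′ → key j ≡ key j′ → j ≡ j′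
  canonical-unique c c′ eq = just-injective (trans (sym c) (trans (cong first eq) c′))

  first-found : (κ : Key) → ∃[ i ] key i ≡ κ → ∃[ i ] first κ ≡ just i × key i ≡ κ
  first-found κ (j , kj) with any? (λ i → key i ≟ₖ κ)
  ... | yes (i , ki) = i , refl , ki
  ... | no ∄         = ⊥-elim (∄ (j , kj))

  canonical-exists : (j : Fin m) → ∃[ i ] Canonical i × key i ≡ key j
  canonical-exists j =
    let i , found , ki = first-found (key j) (j , refl)
    in i , subst (λ κ → first κ ≡ just i) (sym ki) found , ki

module Unfolding (L : LPTS) (K : ℕ) where

  Index : Set
  Index = Fin (length (transitions L))

  T : Index → Transition (states L)
  T = List.lookup (transitions L)

  T-step : {j : Index} {s : Fin (states L)} {a : Action} → src (T j) ≡ s → act (T j) ≡ a → Step L s a (tgt (T j))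
  T-step {j} refl refl = ∈-lookup j

  open Representatives (×-≡-dec _≟_ ℕ._≟_) (λ j → src (T j) , act (T j))

  Edge : Fin (states L) → Index × Fin (states L) → Set
  Edge s (j , s′) = Canonical j × src (T j) ≡ s × 0ℚ < prob (tgt (T j)) s′

  edge? : (s : Fin (states L)) (x : Index × Fin (states L)) → Dec (Edge s x)
  edge? s (j , s′) = canonical? j ×-dec (src (T j) ≟ s) ×-dec (0ℚ <? prob (tgt (T j)) s′)

  open Paths Edge proj₂
  open MaybePairCoding (length (transitions L)) (states L)
  open VecCoding toFin fromFin fromFin-toFin toFin-fromFin K

  N : ℕ
  N = ℕ.suc (length (transitions L) ℕ.* states L) ℕ.^ K

  node : Fin N → Path K
  node = decode

  root : Fin N
  root = encode (empty {K})

  Real : Fin N → Set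
  Real c = Valid (start L) (node c)

  real? : (c : Fin N) → Dec (Real c)
  real? c = valid? edge? (start L) (node c)

  state : Fin N → Fin (states L)
  state c = last (start L) (node c)

  record Expands (c : Fin N) (j : Index) : Set where
    constructor expanding
    field
      room       : 0 ℕ.< free (node c)
      canonical  : Canonical j
      from-state : src (T j) ≡ state c

  expands? : (c : Fin N) (j : Index) → Dec (Expands c j)
  expands? c j = map′ (λ (r , c , s) → expanding r c s) (λ (expanding r c s) → r , c , s)
    ((0 ℕ.<? free (node c)) ×-dec canonical? j ×-dec (src (T j) ≟ state c))

  succ : Fin N → Index → Fin (states L) → Fin N
  succ c j s′ = encode (child (node c) (j , s′))

  step : Fin N → Index → Transition N
  step c j = tr c (act (T j)) (push (succ c j) (tgt (T j)))

  loop : Fin N → Transition N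
  loop c = tr c 0 (dirac c)

  movesFrom : Fin N → List (Transition N)
  movesFrom c with real? c
  ... | yes _ = map (step c) (filter (expands? c) (allFin _))
  ... | no _  = [ loop c ]

  moves : List (Transition N)
  moves = concatMap movesFrom (allFin N)

  data Move (t : Transition N) : Set where
    stepᵐ : ∀ c j → Real c → Expands c j → t ≡ step c j → Move t
    loopᵐ : ∀ c → ¬ Real c → t ≡ loop c → Move t

  ∈-moves⁻ : {t : Transition N} → t ∈ moves → Move t
  ∈-moves⁻ {t} t∈ = let c , t∈c = satisfied (∈-concatMap⁻ movesFrom {xs = allFin N} t∈) in from c t∈c
    where
    from : ∀ c → t ∈ movesFrom c → Move t
    from c t∈c with real? c
    ... | yes r = let j , j∈ , t≡ = ∈-map⁻ (step c) t∈c in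
                  stepᵐ c j r (proj₂ (∈-filter⁻ (expands? c) {xs = allFin _} j∈)) t≡
    ... | no ¬r with here t≡ ← t∈c = loopᵐ c ¬r t≡

  step-∈ : {c : Fin N} {j : Index} → Real c → Expands c j → step c j ∈ moves
  step-∈ {c} {j} r e = ∈-concatMap⁺ movesFrom (lose (∈-allFin c) from)
    where
    from : step c j ∈ movesFrom c
    from with real? c
    ... | yes _ = ∈-map⁺ (step c) (∈-filter⁺ (expands? c) (∈-allFin j) e)
    ... | no ¬r = ⊥-elim (¬r r)

  loop-∈ : {c : Fin N} → ¬ Real c → loop c ∈ moves
  loop-∈ {c} ¬r = ∈-concatMap⁺ movesFrom (lose (∈-allFin c) from)
    where
    from : loop c ∈ movesFrom c
    from with real? c
    ... | yes r = ⊥-elim (¬r r)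
    ... | no _  = here refl

  node-injective : {c c′ : Fin N} → node c ≡ node c′ → c ≡ c′
  node-injective {c} {c′} eq = trans (sym (encode-decode c)) (trans (cong encode eq) (encode-decode c′))

  node-succ : (c : Fin N) (j : Index) (s′ : Fin (states L)) → node (succ c j s′) ≡ child (node c) (j , s′)
  node-succ c j s′ = decode-encode _

  root-real : Real root
  root-real = subst (Valid (start L)) (sym (decode-encode empty)) valid-empty

  state-root : state root ≡ start L
  state-root = trans (cong (last (start L)) (decode-encode empty)) (last-empty {k = K})

  free-root : free (node root) ≡ K
  free-root = trans (cong free (decode-encode empty)) free-empty

  module _ {c : Fin N} {j : Index} (r : Real c) (e : Expands c j) where

    open Expands e

    succ-injective : Injective _≡_ _≡_ (succ c j)
    succ-injective eq = cong proj₂ (proj₂ (child-injective r r room room (encode-injective eq)))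

    succ-real : {s′ : Fin (states L)} → 0ℚ < prob (tgt (T j)) s′ → Real (succ c j s′)
    succ-real {s′} pos = subst (Valid (start L)) (sym (node-succ c j s′))
      (child-valid r room (canonical , from-state , pos))

    state-succ : (s′ : Fin (states L)) → state (succ c j s′) ≡ s′
    state-succ s′ = trans (cong (last (start L)) (node-succ c j s′)) (child-last r room)

    free-succ : (s′ : Fin (states L)) → ℕ.suc (free (node (succ c j s′))) ≡ free (node c)
    free-succ s′ = trans (cong (ℕ.suc ∘ free) (node-succ c j s′)) (child-free (node c) room)

    succ≢root : (s′ : Fin (states L)) → succ c j s′ ≢ root
    succ≢root s′ eq = child≢empty (node c) room (encode-injective eq)

  C : LPTS
  states C = N
  start C = root
  acts C = 0 ∷ acts L
  transitions C = moves
  trans-acts C t∈ with ∈-moves⁻ t∈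
  ... | stepᵐ c j _ _ refl = there (trans-acts L (∈-lookup j))
  ... | loopᵐ c _ refl     = here refl

  same-target : {s : Fin N} {a : Action} {μ μ′ : Dist N} → Move (tr s a μ) → Move (tr s a μ′) → μ ≡ μ′
  same-target (stepᵐ c j r e eq) (stepᵐ c′ j′ r′ e′ eq′) with cong src eq | cong src eq′
  ... | refl | refl = trans (cong tgt eq) (trans (cong (tgt ∘ step c) j≡j′) (sym (cong tgt eq′)))
    where
    j≡j′ : j ≡ j′
    j≡j′ = canonical-unique (Expands.canonical e) (Expands.canonical e′)
      (cong₂ _,_ (trans (Expands.from-state e) (sym (Expands.from-state e′)))
                 (trans (sym (cong act eq)) (cong act eq′)))
  same-target (stepᵐ c _ r _ eq) (loopᵐ c′ ¬r′ eq′) =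
    ⊥-elim (¬r′ (subst Real (trans (sym (cong src eq)) (cong src eq′)) r))
  same-target (loopᵐ c ¬r eq) (stepᵐ c′ _ r′ _ eq′) =
    ⊥-elim (¬r (subst Real (trans (sym (cong src eq′)) (cong src eq)) r′))
  same-target (loopᵐ c _ eq) (loopᵐ c′ _ eq′) with cong src eq | cong src eq′
  ... | refl | refl = trans (cong tgt eq) (sym (cong tgt eq′))

  reactive : Reactive C
  reactive st st′ x = cong (λ μ → prob μ x) (same-target (∈-moves⁻ st) (∈-moves⁻ st′))

  move-∈ : {t : Transition N} → Move t → t ∈ moves
  move-∈ (stepᵐ c j r e refl) = step-∈ r e
  move-∈ (loopᵐ c ¬r refl)    = loop-∈ ¬r

  root-unreached : {t : Transition N} → Move t → ¬ (0ℚ < prob (tgt t) root)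
  root-unreached (stepᵐ c j r e refl) pos =
    let s′ , root≡ , _ = push-support (succ c j) (tgt (T j)) root pos in succ≢root r e s′ (sym root≡)
  root-unreached (loopᵐ c ¬r refl) pos = ¬r (subst Real (dirac-support c root pos) root-real)

  arrival-unique : {t t′ : Transition N} {y : Fin N} → Move t → Move t′ →
    0ℚ < prob (tgt t) y → 0ℚ < prob (tgt t′) y → t ≡ t′
  arrival-unique {y = y} (stepᵐ c j r e refl) (stepᵐ c′ j′ r′ e′ refl) pos pos′
    with push-support (succ c j) (tgt (T j)) y pos | push-support (succ c′ j′) (tgt (T j′)) y pos′
  ... | s′ , y≡ , _ | s″ , y≡′ , _
    with child-injective r r′ (Expands.room e) (Expands.room e′)
           (trans (sym (node-succ c j s′)) (trans (cong node (trans (sym y≡) y≡′)) (node-succ c′ j′ s″)))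
  ... | node≡ , refl with node-injective node≡
  ... | refl = refl
  arrival-unique {y = y} (stepᵐ c j r e refl) (loopᵐ c′ ¬r′ refl) pos pos′ =
    let s′ , y≡ , pos-s′ = push-support (succ c j) (tgt (T j)) y pos
    in ⊥-elim (¬r′ (subst Real (trans (sym y≡) (dirac-support c′ y pos′)) (succ-real r e pos-s′)))
  arrival-unique {y = y} (loopᵐ c ¬r refl) (stepᵐ c′ j′ r′ e′ refl) pos pos′ =
    let s′ , y≡ , pos-s′ = push-support (succ c′ j′) (tgt (T j′)) y pos′
    in ⊥-elim (¬r (subst Real (trans (sym y≡) (dirac-support c y pos)) (succ-real r′ e′ pos-s′)))
  arrival-unique {y = y} (loopᵐ c _ refl) (loopᵐ c′ _ refl) pos pos′
    with trans (sym (dirac-support c y pos)) (dirac-support c′ y pos′)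
  ... | refl = refl

  real-parent : {y : Fin N} → Real y → y ≢ root →
    ∃[ c ] ∃[ j ] ∃[ s′ ] Real c × Expands c j × y ≡ succ c j s′ × 0ℚ < prob (tgt (T j)) s′
  real-parent {y} r y≢root with parent r (λ eq → y≢root (trans (sym (encode-decode y)) (cong encode eq)))
  ... | record { path = p ; label = j , s′ ; splits = splits ; valid = v ; room = u ; edge = canon , src≡ , pos } =
    encode p , j , s′
    , subst (Valid (start L)) (sym p≡) v
    , expanding (subst (λ q → 0 ℕ.< free q) (sym p≡) u) canon (trans src≡ (cong (last (start L)) (sym p≡)))
    , trans (sym (encode-decode y)) (cong encode (trans splits (cong (λ q → child q (j , s′)) (sym p≡))))
    , pos
    where
    p≡ : node (encode p) ≡ p
    p≡ = decode-encode p

  arrival : (y : Fin N) → y ≢ root → ∃[ t ] Move t × 0ℚ < prob (tgt t) y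
  arrival y y≢root with real? y
  ... | no ¬r = loop y , loopᵐ y ¬r refl , dirac-self y
  ... | yes r with real-parent r y≢root
  ...   | c , j , s′ , rc , ec , refl , pos =
    step c j , stepᵐ c j rc ec refl ,
    subst (0ℚ <_) (sym (push-apply (succ-injective rc ec) (tgt (T j)) s′)) pos

  tree : StochasticTree C
  tree = (λ t∈ → root-unreached (∈-moves⁻ t∈))
       , λ y y≢root → let t , mv , pos = arrival y y≢root in
           t , move-∈ mv , pos , λ t′ t′∈ pos′ → same (arrival-unique (∈-moves⁻ t′∈) mv pos′ pos)
    where
    same : {t t′ : Transition N} → t′ ≡ t → (src t′ ≡ src t) × (act t′ ≡ act t) × (tgt t′ ≗D tgt t)
    same refl = refl , refl , λ _ → refl

  canonical-step : {s : Fin (states L)} {a : Action} {μ : Dist (states L)} → Step L s a μ →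
    ∃[ j ] Canonical j × src (T j) ≡ s × act (T j) ≡ a
  canonical-step st =
    let j , canon , key≡ = canonical-exists (index st)
        key≡′ = trans key≡ (cong (λ t → src t , act t) (sym (lookup-index st)))
    in j , canon , cong proj₁ key≡′ , cong proj₂ key≡′

  Tracks : Fin N → Fin (states L) → Set
  Tracks c s = Real c × state c ≡ s

  tracks-simulation : IsStrongSimulation C L Tracks
  tracks-simulation c s (r , state≡) a μ st with ∈-moves⁻ st
  ... | loopᵐ c′ ¬r eq = ⊥-elim (¬r (subst Real (cong src eq) r))
  ... | stepᵐ c′ j _ e eq with cong src eq | cong act eq | cong tgt eq
  ...   | refl | refl | refl =
    tgt (T j) , T-step (trans (Expands.from-state e) state≡) refl ,
    Lift-mono {μ = μ} {tgt (T j)} tracks (push-coupling (succ c j) (tgt (T j)))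
    where
    tracks : ∀ y s′ → y ≡ succ c j s′ × 0ℚ < prob (tgt (T j)) s′ → Tracks y s′
    tracks y s′ (refl , pos) = succ-real r e pos , state-succ r e s′

  C⪯L : C ⪯ L
  C⪯L = Tracks , tracks-simulation , root-real , state-root

  module _ (L₂ : LPTS) (L-reactive : Reactive L) {R : Fin N → Fin (states L₂) → Set}
           (R-simulation : IsStrongSimulation C L₂ R) where

    -- By reactivity every move of L from state c is the canonical one, a move of C from c;
    -- so R yields e-step similarity as long as the tree has room for e more steps.
    Sim-from-unfolding : ∀ e c t → Real c → e ℕ.≤ free (node c) → R c t → Sim L L₂ e (state c) t
    Sim-from-unfolding ℕ.zero    c t r e≤free Rct = tt
    Sim-from-unfolding (ℕ.suc e) c t r e<free Rct a μ st with canonical-step st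
    ... | j , canon , src≡ , act≡ =
      let ν , st₂ , lift = R-simulation c t Rct (act (T j)) _ (step-∈ r expands) in
      ν , subst (λ a → Step L₂ t a ν) act≡ st₂ ,
      Lift-≗ˡ {R = Sim L L₂ e} {tgt (T j)} {μ} {ν} (L-reactive (T-step src≡ act≡) st)
        (Lift-mono {μ = tgt (T j)} {ν} next (Lift-push⁻ {μ = tgt (T j)} {ν} (succ-injective r expands) lift))
      where
      expands : Expands c j
      expands = expanding (ℕ.≤-trans (ℕ.s≤s ℕ.z≤n) e<free) canon src≡
      next : ∀ s′ y → R (succ c j s′) y × 0ℚ < prob (tgt (T j)) s′ → Sim L L₂ e s′ y
      next s′ y (R′ , pos) = subst (λ s → Sim L L₂ e s y) (state-succ r expands s′)
        (Sim-from-unfolding e (succ c j s′) y (succ-real r expands pos)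
          (ℕ.≤-pred (subst (ℕ.suc e ℕ.≤_) (sym (free-succ r expands s′)) e<free)) R′)

corollary1 : (L₁ L₂ : LPTS) → Reactive L₁ → ¬ (L₁ ⪯ L₂) →
    Σ LPTS λ C → Reactive C × StochasticTree C × (C ⪯ L₁) × ¬ (C ⪯ L₂)
corollary1 L₁ L₂ L₁-reactive L₁⋠L₂ = C , reactive , tree , C⪯L , C⋠L₂
  where
  K = states L₁ ℕ.* states L₂
  open Unfolding L₁ K
  C⋠L₂ : ¬ (C ⪯ L₂)
  C⋠L₂ (R , R-simulation , R-start) = ¬⪯⇒¬Sim L₁ L₂ L₁⋠L₂
    (subst (λ s → Sim L₁ L₂ K s (start L₂)) state-root
      (Sim-from-unfolding L₂ L₁-reactive R-simulation K root (start L₂)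
        root-real (ℕ.≤-reflexive (sym free-root)) R-start))
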